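{- Every binary linear code of length $n\le 33$, dimension $5$ and minimum Hamming distance $15$ contains a codeword of Hamming weight $16$.
   Context: A binary linear code of length $n$ and dimension $k$ is a $k$-dimensional subspace of $\mathbb{F}_2^n$; its minimum Hamming distance is the minimum Hamming weight of a nonzero codeword. -}

module Defs where

open import Data.Nat using (ℕ; zero; suc; _+_; _≤_)
open import Data.Bool using (Bool; true; false; _xor_)
open import Data.Fin using (Fin)
open import Data.Vec using (Vec; replicate; zipWith; count; foldr; tabulate)
open import Data.Product using (Σ; ∃; _×_; _,_)
open import Relation.Binary.PropositionalEquality using (_≡_)
open import Relation.Nullary using (¬_)
open import Data.Bool.Properties using (T?)
open import Function using (id)

-- Vectors of F₂^n, with F₂ represented as Bool (false = 0, true = 1).
Word : ℕ → Set
Word n = Vec Bool n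

zeroWord : ∀ {n} → Word n
zeroWord = replicate _ false

_⊕_ : ∀ {n} → Word n → Word n → Word n
_⊕_ = zipWith _xor_

_·_ : ∀ {n} → Bool → Word n → Word n
true  · x = x
false · x = zeroWord

weight : ∀ {n} → Word n → ℕ
weight = count T?

lincomb : ∀ {k n} → (Fin k → Bool) → (Fin k → Word n) → Word n
lincomb {k} c g = foldr (λ _ → Word _) _⊕_ zeroWord (tabulate (λ i → c i · g i))

LinIndep : ∀ {k n} → (Fin k → Word n) → Set
LinIndep {k} g = ∀ (c : Fin k → Bool) → lincomb c g ≡ zeroWord → ∀ i → c i ≡ false

-- A binary linear [n,k] code: a subset C of F₂^n (given as a predicate)
-- which is a k-dimensional subspace, i.e. has a basis of k vectors:
-- k linearly independent vectors in C whose span is exactly C.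
record LinearCode (n k : ℕ) : Set₁ where
  field
    Code    : Word n → Set
    basis   : Fin k → Word n
    indep   : LinIndep basis
    spans   : ∀ x → Code x → ∃ λ (c : Fin k → Bool) → x ≡ lincomb c basis
    inCode  : ∀ (c : Fin k → Bool) → Code (lincomb c basis)

-- minimum distance d: minimum weight of a nonzero codeword equals d
HasMinDist : ∀ {n k} → LinearCode n k → ℕ → Set
HasMinDist C d =
  (∀ x → LinearCode.Code C x → ¬ (x ≡ zeroWord) → d ≤ weight x) ×
  (∃ λ x → LinearCode.Code C x × ¬ (x ≡ zeroWord) × weight x ≡ d)

module Submission where

-- A code with basis g₁,…,g₅ ∈ F₂ⁿ is described by the list M of its n columns
-- in F₂⁵: the codeword Σ cᵢgᵢ has weight wt M c = #{v ∈ M : c·v = 1}.  For a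
-- codeword b, the residual list (columns v with b·v = 0) satisfies the
-- identity  wt M a + wt M (a+b) = wt M b + 2·wt (residual b M) a,  and has
-- length |M| − wt M b.  Since every column v ≠ 0 is hit by exactly half of
-- all c ∈ F₂ᵏ, the weights of a list M average at most |M|/2, which gives an
-- averaging (pigeonhole) principle producing light vectors outside any
-- small exceptional set.
--
-- Suppose no weight 16 occurs and X has weight 15.  A parity argument on the
-- residual at X gives a [≤18,4,≥9] code, and two residual steps driven by the
-- pigeonhole principle lead to a [≤9,3,≥5] and then a [≤4,2,≥3] code; the
-- latter violates the averaging bound.

open import Defs
open import Algebra.Bundles using (CommutativeRing)
open import Data.Bool using (Bool; true; false; _xor_; _∧_; not; if_then_else_)
open import Data.Bool.Properties as BoolP
  using (xor-assoc; xor-same; xor-identityʳ; ∧-distribʳ-xor; xor-∧-commutativeRing)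
open import Algebra.Properties.CommutativeSemigroup
  (CommutativeRing.+-commutativeSemigroup xor-∧-commutativeRing) using (interchange)
open import Data.Empty using (⊥)
open import Data.Fin using (Fin; zero; suc)
open import Data.List using (List; []; _∷_; _++_; map; length)
open import Data.List.Membership.Propositional using (_∈_; _∉_)
open import Data.List.Membership.Propositional.Properties using (∈-++⁺ˡ; ∈-++⁺ʳ; ∈-map⁺)
open import Data.List.Relation.Unary.Any using (here; there; any?)
open import Data.Nat using (ℕ; zero; suc; _+_; _*_; _^_; _≤_; _<_; z≤n; s≤s; _<?_)
open import Data.Nat.Properties
open import Data.Nat.Tactic.RingSolver using (solve-∀)
open import Data.Product using (∃; _×_; _,_; proj₁; proj₂)
open import Data.Sum using (_⊎_; inj₁; inj₂)
open import Data.Vec using ([]; _∷_; head; tail; tabulate; lookup)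
open import Data.Vec.Properties using (≡-dec; tabulate∘lookup)
open import Relation.Binary.PropositionalEquality
open import Relation.Nullary using (¬_; Dec; yes; no; does; contradiction)
open import Relation.Nullary.Decidable using (map′; dec-true; decidable-stable; ¬?; _×-dec_; _⊎-dec_)

bit : Bool → ℕ
bit true  = 1
bit false = 0

dot : ∀ {k} → Word k → Word k → Bool
dot []       []       = false
dot (c ∷ cs) (v ∷ vs) = (c ∧ v) xor dot cs vs

_≟ʷ_ : ∀ {k} (a b : Word k) → Dec (a ≡ b)
_≟ʷ_ = ≡-dec BoolP._≟_

⊕-cancelʳ : ∀ {k} (a b : Word k) → (a ⊕ b) ⊕ b ≡ a
⊕-cancelʳ []      []      = refl
⊕-cancelʳ (x ∷ a) (y ∷ b) = cong₂ _∷_ xor-cancelʳ (⊕-cancelʳ a b)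
  where
  xor-cancelʳ : (x xor y) xor y ≡ x
  xor-cancelʳ = trans (xor-assoc x y y) (trans (cong (x xor_) (xor-same y)) (xor-identityʳ x))

dot-⊕ : ∀ {k} (a b v : Word k) → dot (a ⊕ b) v ≡ dot a v xor dot b v
dot-⊕ []      []      []       = refl
dot-⊕ (x ∷ a) (y ∷ b) (v ∷ vs) = begin
  ((x xor y) ∧ v) xor dot (a ⊕ b) vs
    ≡⟨ cong₂ _xor_ (∧-distribʳ-xor v x y) (dot-⊕ a b vs) ⟩
  ((x ∧ v) xor (y ∧ v)) xor (dot a vs xor dot b vs)
    ≡⟨ interchange (x ∧ v) (y ∧ v) (dot a vs) (dot b vs) ⟩
  ((x ∧ v) xor dot a vs) xor ((y ∧ v) xor dot b vs) ∎
  where open ≡-Reasoning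

+-interchange : ∀ p q r s → (p + q) + (r + s) ≡ (p + r) + (q + s)
+-interchange = solve-∀

-- A generator matrix of a binary [n,k] code, given by its list of n columns
-- in F₂ᵏ; the codeword with coefficient vector c has weight wt M c.
Columns : ℕ → Set
Columns k = List (Word k)

wt : ∀ {k} → Columns k → Word k → ℕ
wt []      c = 0
wt (v ∷ M) c = bit (dot c v) + wt M c

residual : ∀ {k} → Word k → Columns k → Columns k
residual b []      = []
residual b (v ∷ M) = if dot b v then residual b M else v ∷ residual b M

length-residual : ∀ {k} (b : Word k) (M : Columns k) → length (residual b M) + wt M b ≡ length M
length-residual b []      = refl
length-residual b (v ∷ M) with dot b v
... | true  = trans (+-suc _ (wt M b)) (cong suc (length-residual b M))
... | false = cong suc (length-residual b M)

length-residual-≤ : ∀ {k} (b : Word k) (M : Columns k) d m →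
                    d ≤ wt M b → length M ≤ d + m → length (residual b M) ≤ m
length-residual-≤ b M d m d≤wb M≤d+m = +-cancelˡ-≤ d _ m (begin
  d + length (residual b M)      ≤⟨ +-monoˡ-≤ _ d≤wb ⟩
  wt M b + length (residual b M) ≡⟨ +-comm (wt M b) _ ⟩
  length (residual b M) + wt M b ≡⟨ length-residual b M ⟩
  length M                       ≤⟨ M≤d+m ⟩
  d + m                          ∎)
  where open ≤-Reasoning

-- One column of the residual identity: α = a·v, β = b·v, and the column
-- survives in the residual exactly when β = 0.
bit-xor : ∀ α β → bit α + bit (α xor β) ≡ bit β + 2 * bit (not β ∧ α)
bit-xor true  true  = refl
bit-xor true  false = refl
bit-xor false true  = refl
bit-xor false false = refl

wt-residual-∷ : ∀ {k} (a b v : Word k) M →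
                wt (residual b (v ∷ M)) a ≡ bit (not (dot b v) ∧ dot a v) + wt (residual b M) a
wt-residual-∷ a b v M with dot b v
... | true  = refl
... | false = refl

wt-residual : ∀ {k} (a b : Word k) (M : Columns k) →
              wt M a + wt M (a ⊕ b) ≡ wt M b + 2 * wt (residual b M) a
wt-residual a b []      = refl
wt-residual a b (v ∷ M) = begin
  (bit α + wt M a) + (bit (dot (a ⊕ b) v) + wt M (a ⊕ b))
    ≡⟨ cong (λ γ → (bit α + wt M a) + (bit γ + wt M (a ⊕ b))) (dot-⊕ a b v) ⟩
  (bit α + wt M a) + (bit (α xor β) + wt M (a ⊕ b))
    ≡⟨ +-interchange (bit α) (wt M a) (bit (α xor β)) (wt M (a ⊕ b)) ⟩
  (bit α + bit (α xor β)) + (wt M a + wt M (a ⊕ b))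
    ≡⟨ cong₂ _+_ (bit-xor α β) (wt-residual a b M) ⟩
  (bit β + 2 * bit (not β ∧ α)) + (wt M b + 2 * wt (residual b M) a)
    ≡⟨ +-2*-interchange (bit β) (bit (not β ∧ α)) (wt M b) (wt (residual b M) a) ⟩
  (bit β + wt M b) + 2 * (bit (not β ∧ α) + wt (residual b M) a)
    ≡⟨ cong (λ r → (bit β + wt M b) + 2 * r) (sym (wt-residual-∷ a b v M)) ⟩
  (bit β + wt M b) + 2 * wt (residual b (v ∷ M)) a ∎
  where
  open ≡-Reasoning
  α = dot a v
  β = dot b v
  +-2*-interchange : ∀ p q r s → (p + 2 * q) + (r + 2 * s) ≡ (p + r) + 2 * (q + s)
  +-2*-interchange = solve-∀

sumAll : ∀ k → (Word k → ℕ) → ℕ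
sumAll zero    f = f []
sumAll (suc k) f = sumAll k (λ c → f (true ∷ c)) + sumAll k (λ c → f (false ∷ c))

sumAll-cong : ∀ k {f g : Word k → ℕ} → (∀ c → f c ≡ g c) → sumAll k f ≡ sumAll k g
sumAll-cong zero    f≗g = f≗g []
sumAll-cong (suc k) f≗g = cong₂ _+_ (sumAll-cong k (λ c → f≗g (true ∷ c)))
                                    (sumAll-cong k (λ c → f≗g (false ∷ c)))

sumAll-mono : ∀ k {f g : Word k → ℕ} → (∀ c → f c ≤ g c) → sumAll k f ≤ sumAll k g
sumAll-mono zero    f≤g = f≤g []
sumAll-mono (suc k) f≤g = +-mono-≤ (sumAll-mono k (λ c → f≤g (true ∷ c)))
                                   (sumAll-mono k (λ c → f≤g (false ∷ c)))

sumAll-+ : ∀ k (f g : Word k → ℕ) → sumAll k (λ c → f c + g c) ≡ sumAll k f + sumAll k g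
sumAll-+ zero    f g = refl
sumAll-+ (suc k) f g = begin
  sumAll k (λ c → f (true ∷ c) + g (true ∷ c)) + sumAll k (λ c → f (false ∷ c) + g (false ∷ c))
    ≡⟨ cong₂ _+_ (sumAll-+ k _ _) (sumAll-+ k _ _) ⟩
  (F₁ + G₁) + (F₀ + G₀)
    ≡⟨ +-interchange F₁ G₁ F₀ G₀ ⟩
  (F₁ + F₀) + (G₁ + G₀) ∎
  where
  open ≡-Reasoning
  F₁ = sumAll k (λ c → f (true ∷ c))
  F₀ = sumAll k (λ c → f (false ∷ c))
  G₁ = sumAll k (λ c → g (true ∷ c))
  G₀ = sumAll k (λ c → g (false ∷ c))

sumAll-*ˡ : ∀ k m (f : Word k → ℕ) → sumAll k (λ c → m * f c) ≡ m * sumAll k f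
sumAll-*ˡ zero    m f = refl
sumAll-*ˡ (suc k) m f = trans (cong₂ _+_ (sumAll-*ˡ k m _) (sumAll-*ˡ k m _))
                              (sym (*-distribˡ-+ m _ _))

sumAll-const : ∀ k m → sumAll k (λ _ → m) ≡ m * 2 ^ k
sumAll-const zero    m = sym (*-identityʳ m)
sumAll-const (suc k) m = trans (cong₂ _+_ (sumAll-const k m) (sumAll-const k m)) (two-copies m (2 ^ k))
  where
  two-copies : ∀ m x → m * x + m * x ≡ m * (2 * x)
  two-copies = solve-∀

sumAll-dot : ∀ k (v : Word k) → 2 * sumAll k (λ c → bit (dot c v)) ≤ 2 ^ k
sumAll-dot zero    []         = z≤n
sumAll-dot (suc k) (true ∷ v) = ≤-reflexive (cong (2 *_) (begin
  sumAll k (λ c → bit (not (dot c v))) + sumAll k (λ c → bit (dot c v))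
    ≡⟨ sym (sumAll-+ k _ _) ⟩
  sumAll k (λ c → bit (not (dot c v)) + bit (dot c v))
    ≡⟨ sumAll-cong k (λ c → bit-not (dot c v)) ⟩
  sumAll k (λ _ → 1)
    ≡⟨ sumAll-const k 1 ⟩
  1 * 2 ^ k
    ≡⟨ *-identityˡ (2 ^ k) ⟩
  2 ^ k ∎))
  where
  open ≡-Reasoning
  bit-not : ∀ β → bit (not β) + bit β ≡ 1
  bit-not true  = refl
  bit-not false = refl
sumAll-dot (suc k) (false ∷ v) = begin
  2 * (S + S)    ≡⟨ *-distribˡ-+ 2 S S ⟩
  2 * S + 2 * S  ≤⟨ +-mono-≤ (sumAll-dot k v) (sumAll-dot k v) ⟩
  2 ^ k + 2 ^ k  ≡⟨ cong (2 ^ k +_) (sym (+-identityʳ (2 ^ k))) ⟩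
  2 ^ suc k      ∎
  where
  open ≤-Reasoning
  S = sumAll k (λ c → bit (dot c v))

sumAll-wt : ∀ k (M : Columns k) → 2 * sumAll k (wt M) ≤ 2 ^ k * length M
sumAll-wt k []      = ≤-reflexive (trans (cong (2 *_) (sumAll-const k 0)) (sym (*-zeroʳ (2 ^ k))))
sumAll-wt k (v ∷ M) = begin
  2 * sumAll k (λ c → bit (dot c v) + wt M c)
    ≡⟨ cong (2 *_) (sumAll-+ k _ (wt M)) ⟩
  2 * (sumAll k (λ c → bit (dot c v)) + sumAll k (wt M))
    ≡⟨ *-distribˡ-+ 2 (sumAll k (λ c → bit (dot c v))) (sumAll k (wt M)) ⟩
  2 * sumAll k (λ c → bit (dot c v)) + 2 * sumAll k (wt M)
    ≤⟨ +-mono-≤ (sumAll-dot k v) (sumAll-wt k M) ⟩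
  2 ^ k + 2 ^ k * length M
    ≡⟨ sym (*-suc (2 ^ k) (length M)) ⟩
  2 ^ k * length (v ∷ M) ∎
  where open ≤-Reasoning

mult : ∀ {k} → Word k → List (Word k) → ℕ
mult c []      = 0
mult c (s ∷ S) = bit (does (c ≟ʷ s)) + mult c S

sumAll-δ : ∀ k (a : Word k) → sumAll k (λ c → bit (does (c ≟ʷ a))) ≡ 1
sumAll-δ zero    []         = refl
sumAll-δ (suc k) (true ∷ a)  = cong₂ _+_ (sumAll-δ k a) (sumAll-const k 0)
sumAll-δ (suc k) (false ∷ a) = cong₂ _+_ (sumAll-const k 0) (sumAll-δ k a)

sumAll-mult : ∀ k (S : List (Word k)) → sumAll k (λ c → mult c S) ≡ length S
sumAll-mult k []      = sumAll-const k 0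
sumAll-mult k (s ∷ S) = trans (sumAll-+ k _ _) (cong₂ _+_ (sumAll-δ k s) (sumAll-mult k S))

∈⇒mult : ∀ {k} {c : Word k} {S} → c ∈ S → 1 ≤ mult c S
∈⇒mult {c = c} (here refl) = ≤-trans (≤-reflexive (cong bit (sym (dec-true (c ≟ʷ c) refl)))) (m≤m+n _ _)
∈⇒mult (there c∈S)         = ≤-trans (∈⇒mult c∈S) (m≤n+m _ _)

sumAll-lower : ∀ k (f : Word k → ℕ) (S : List (Word k)) K →
               (∀ c → c ∈ S ⊎ K ≤ f c) → K * 2 ^ k ≤ sumAll k f + K * length S
sumAll-lower k f S K cover = begin
  K * 2 ^ k                                 ≡⟨ sym (sumAll-const k K) ⟩
  sumAll k (λ _ → K)                        ≤⟨ sumAll-mono k pointwise ⟩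
  sumAll k (λ c → f c + K * mult c S)       ≡⟨ sumAll-+ k f _ ⟩
  sumAll k f + sumAll k (λ c → K * mult c S) ≡⟨ cong (sumAll k f +_) (sumAll-*ˡ k K _) ⟩
  sumAll k f + K * sumAll k (λ c → mult c S) ≡⟨ cong (λ m → sumAll k f + K * m) (sumAll-mult k S) ⟩
  sumAll k f + K * length S                 ∎
  where
  open ≤-Reasoning
  pointwise : ∀ c → K ≤ f c + K * mult c S
  pointwise c with cover c
  ... | inj₁ c∈S = ≤-trans (≤-trans (≤-reflexive (sym (*-identityʳ K))) (*-monoʳ-≤ K (∈⇒mult c∈S))) (m≤n+m _ _)
  ... | inj₂ K≤f = ≤-trans K≤f (m≤m+n _ _)

exists? : ∀ k {P : Word k → Set} → (∀ c → Dec (P c)) → Dec (∃ P)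
exists? zero    {P} P? = map′ ([] ,_) (λ { ([] , p) → p }) (P? [])
exists? (suc k) {P} P? =
  map′ join split (exists? k (λ c → P? (true ∷ c)) ⊎-dec exists? k (λ c → P? (false ∷ c)))
  where
  join : (∃ λ c → P (true ∷ c)) ⊎ (∃ λ c → P (false ∷ c)) → ∃ P
  join (inj₁ (c , p)) = true ∷ c , p
  join (inj₂ (c , p)) = false ∷ c , p
  split : ∃ P → (∃ λ c → P (true ∷ c)) ⊎ (∃ λ c → P (false ∷ c))
  split (true ∷ c , p)  = inj₁ (c , p)
  split (false ∷ c , p) = inj₂ (c , p)

light-vector : ∀ {k} (M : Columns k) (S : List (Word k)) K m → length M ≤ m →
               2 ^ k * m + 2 * (K * length S) < 2 * (K * 2 ^ k) →
               ∃ λ c → c ∉ S × wt M c < K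
light-vector {k} M S K m M≤m small =
  decidable-stable (exists? k (λ c → ¬? (any? (c ≟ʷ_) S) ×-dec (wt M c <? K))) no-light-absurd
  where
  no-light-absurd : ¬ ¬ (∃ λ c → c ∉ S × wt M c < K)
  no-light-absurd ∄ = <⇒≱ small (begin
    2 * (K * 2 ^ k)                         ≤⟨ *-monoʳ-≤ 2 (sumAll-lower k (wt M) S K cover) ⟩
    2 * (sumAll k (wt M) + K * length S)    ≡⟨ *-distribˡ-+ 2 (sumAll k (wt M)) (K * length S) ⟩
    2 * sumAll k (wt M) + 2 * (K * length S) ≤⟨ +-monoˡ-≤ _ (sumAll-wt k M) ⟩
    2 ^ k * length M + 2 * (K * length S)   ≤⟨ +-monoˡ-≤ _ (*-monoʳ-≤ (2 ^ k) M≤m) ⟩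
    2 ^ k * m + 2 * (K * length S)          ∎)
    where
    open ≤-Reasoning
    cover : ∀ c → c ∈ S ⊎ K ≤ wt M c
    cover c with any? (c ≟ʷ_) S | wt M c <? K
    ... | yes c∈S | _        = inj₁ c∈S
    ... | no c∉S  | yes wc<K = contradiction (c , c∉S , wc<K) ∄
    ... | no _    | no wc≮K  = inj₂ (≮⇒≥ wc≮K)

-- If S lists a subspace U of F₂ᵏ, then adjoin b S lists U + ⟨b⟩ = U ∪ (U + b).
adjoin : ∀ {k} → Word k → List (Word k) → List (Word k)
adjoin b S = S ++ map (_⊕ b) S

∉-adjoin : ∀ {k} {a b : Word k} S → a ∉ adjoin b S → a ∉ S × a ⊕ b ∉ S
∉-adjoin {a = a} {b} S a∉ =
  (λ a∈S → a∉ (∈-++⁺ˡ a∈S)) ,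
  (λ a+b∈S → a∉ (∈-++⁺ʳ S (subst (_∈ map (_⊕ b) S) (⊕-cancelʳ a b) (∈-map⁺ (_⊕ b) a+b∈S))))

residual-bound : ∀ {k} (M : Columns k) S (b : Word k) d e →
                 (∀ a → a ∉ S → d ≤ wt M a) → wt M b ≤ e →
                 ∀ a → a ∉ adjoin b S → d + d ≤ e + 2 * wt (residual b M) a
residual-bound M S b d e heavy wb≤e a a∉ = begin
  d + d                               ≤⟨ +-mono-≤ (heavy a a∉S) (heavy (a ⊕ b) a+b∉S) ⟩
  wt M a + wt M (a ⊕ b)               ≡⟨ wt-residual a b M ⟩
  wt M b + 2 * wt (residual b M) a    ≤⟨ +-monoˡ-≤ _ wb≤e ⟩
  e + 2 * wt (residual b M) a         ∎
  where
  open ≤-Reasoning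
  a∉S = proj₁ (∉-adjoin S a∉)
  a+b∉S = proj₂ (∉-adjoin S a∉)

-- One descent step: from a code of length ≤ d + m whose codewords off S have
-- weight ≥ d, the pigeonhole principle yields b of weight exactly d, whose
-- residual has length ≤ m and weights ≥ d/2 off S + ⟨b⟩.
descend : ∀ {k} (M : Columns k) S d m → length M ≤ d + m → (∀ a → a ∉ S → d ≤ wt M a) →
          2 ^ k * (d + m) + 2 * (suc d * length S) < 2 * (suc d * 2 ^ k) →
          ∃ λ b → length (residual b M) ≤ m × (∀ a → a ∉ adjoin b S → d ≤ 2 * wt (residual b M) a)
descend M S d m M≤d+m heavy small =
  let (b , b∉S , wb<1+d) = light-vector M S (suc d) (d + m) M≤d+m small
      wb≤d = m<1+n⇒m≤n wb<1+d
  in b , length-residual-≤ b M d m (heavy b b∉S) M≤d+m ,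
     λ a a∉ → +-cancelˡ-≤ d d _ (residual-bound M S b d d heavy wb≤d a a∉)

half-≤ : ∀ m r → 2 * m ≤ suc (2 * r) → m ≤ r
half-≤ m r 2m≤1+2r = m<1+n⇒m≤n (*-cancelˡ-< 2 m (suc r) (≤-trans (s≤s 2m≤1+2r) (≤-reflexive (sym (*-suc 2 r)))))

at-least-15 : ∀ x → 15 ≤ x → x ≢ 16 → x ≡ 15 ⊎ 17 ≤ x
at-least-15 x 15≤x x≢16 with m≤n⇒m<n∨m≡n 15≤x
... | inj₂ 15≡x = inj₁ (sym 15≡x)
... | inj₁ 16≤x with m≤n⇒m<n∨m≡n 16≤x
...   | inj₁ 17≤x = inj₂ 17≤x
...   | inj₂ 16≡x = contradiction (sym 16≡x) x≢16

-- Parity step at a codeword of weight 15: two weights ≥ 15, both ≠ 16, whose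
-- sum is 15 + 2r cannot both be 15 (parity), so their sum is ≥ 32 and r ≥ 9.
parity-bound : ∀ x y r → 15 ≤ x → 15 ≤ y → x ≢ 16 → y ≢ 16 → x + y ≡ 15 + 2 * r → 9 ≤ r
parity-bound x y r 15≤x 15≤y x≢16 y≢16 x+y≡15+2r =
  half-≤ 9 r (s≤s (+-cancelˡ-≤ 15 17 (2 * r) (≤-trans sum≥32 (≤-reflexive x+y≡15+2r))))
  where
  sum≥32 : 32 ≤ x + y
  sum≥32 with at-least-15 x 15≤x x≢16 | at-least-15 y 15≤y y≢16
  ... | inj₁ refl | inj₁ refl  = contradiction (sym (+-cancelˡ-≡ 15 15 (2 * r) x+y≡15+2r)) (even≢odd r 7)
  ... | inj₁ refl | inj₂ 17≤y = +-monoʳ-≤ 15 17≤y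
  ... | inj₂ 17≤x | _         = +-mono-≤ 17≤x 15≤y

-- The core of the theorem, for generator matrices: if all nonzero codewords
-- have weight ≥ 15 and none has weight 16, no codeword has weight 15.  The
-- residual at such a codeword X is a code of length ≤ 18 with weights ≥ 9 off
-- ⟨X⟩; two descent steps give length ≤ 9 with weights ≥ 5 off a plane, then
-- length ≤ 4 with weights ≥ 3 off a 3-space, contradicting averaging.
no-weight-15 : (M : Columns 5) → length M ≤ 33 → (∀ c → c ≢ zeroWord → 15 ≤ wt M c) →
               (∀ c → wt M c ≢ 16) → ∀ X → wt M X ≡ 15 → ⊥
no-weight-15 M M≤33 min15 no16 X wX≡15 =
  let (z , M₂≤9 , 2τ≥9) = descend M₁ S₁ 9 9 M₁≤18 ρ≥9 (<ᵇ⇒< _ _ _)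
      τ≥5 = λ a a∉ → half-≤ 5 _ (s≤s (2τ≥9 a a∉))
      (t , M₃≤4 , 2σ≥5) = descend (residual z M₁) (adjoin z S₁) 5 4 M₂≤9 τ≥5 (<ᵇ⇒< _ _ _)
      (u , u∉ , σu<3) = light-vector (residual t (residual z M₁)) (adjoin t (adjoin z S₁)) 3 4 M₃≤4
                                     (<ᵇ⇒< _ _ _)
  in <⇒≱ σu<3 (half-≤ 3 _ (s≤s (2σ≥5 u u∉)))
  where
  M₁ = residual X M
  S₁ = adjoin X (zeroWord ∷ [])
  M₁≤18 : length M₁ ≤ 9 + 9
  M₁≤18 = length-residual-≤ X M 15 18 (≤-reflexive (sym wX≡15)) M≤33
  ρ≥9 : ∀ a → a ∉ S₁ → 9 ≤ wt M₁ a
  ρ≥9 a a∉ = parity-bound (wt M a) (wt M (a ⊕ X)) (wt M₁ a)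
               (min15 a (λ a≡0 → a∉⟨0⟩ (here a≡0))) (min15 (a ⊕ X) (λ a+X≡0 → a+X∉⟨0⟩ (here a+X≡0)))
               (no16 a) (no16 (a ⊕ X))
               (trans (wt-residual a X M) (cong (_+ 2 * wt M₁ a) wX≡15))
    where
    a∉⟨0⟩ = proj₁ (∉-adjoin {b = X} (zeroWord ∷ []) a∉)
    a+X∉⟨0⟩ = proj₂ (∉-adjoin {b = X} (zeroWord ∷ []) a∉)

columns : ∀ {k n} → (Fin k → Word n) → Columns k
columns {n = zero}  g = []
columns {n = suc n} g = tabulate (λ i → head (g i)) ∷ columns (λ i → tail (g i))

length-columns : ∀ {k n} (g : Fin k → Word n) → length (columns g) ≡ n
length-columns {n = zero}  g = refl
length-columns {n = suc n} g = cong suc (length-columns (λ i → tail (g i)))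

head-⊕ : ∀ {n} (x y : Word (suc n)) → head (x ⊕ y) ≡ head x xor head y
head-⊕ (a ∷ x) (b ∷ y) = refl

tail-⊕ : ∀ {n} (x y : Word (suc n)) → tail (x ⊕ y) ≡ tail x ⊕ tail y
tail-⊕ (a ∷ x) (b ∷ y) = refl

head-· : ∀ {n} β (x : Word (suc n)) → head (β · x) ≡ β ∧ head x
head-· true  (a ∷ x) = refl
head-· false (a ∷ x) = refl

tail-· : ∀ {n} β (x : Word (suc n)) → tail (β · x) ≡ β · tail x
tail-· true  (a ∷ x) = refl
tail-· false (a ∷ x) = refl

head-lincomb : ∀ {k n} (cf : Fin k → Bool) (g : Fin k → Word (suc n)) →
               head (lincomb cf g) ≡ dot (tabulate cf) (tabulate (λ i → head (g i)))
head-lincomb {zero}  cf g = refl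
head-lincomb {suc k} cf g =
  trans (head-⊕ (cf zero · g zero) (lincomb (λ i → cf (suc i)) (λ i → g (suc i))))
        (cong₂ _xor_ (head-· (cf zero) (g zero)) (head-lincomb (λ i → cf (suc i)) (λ i → g (suc i))))

tail-lincomb : ∀ {k n} (cf : Fin k → Bool) (g : Fin k → Word (suc n)) →
               tail (lincomb cf g) ≡ lincomb cf (λ i → tail (g i))
tail-lincomb {zero}  cf g = refl
tail-lincomb {suc k} cf g =
  trans (tail-⊕ (cf zero · g zero) (lincomb (λ i → cf (suc i)) (λ i → g (suc i))))
        (cong₂ _⊕_ (tail-· (cf zero) (g zero)) (tail-lincomb (λ i → cf (suc i)) (λ i → g (suc i))))

weight-[] : (x : Word 0) → weight x ≡ 0
weight-[] [] = refl

weight-∷ : ∀ {n} (x : Word (suc n)) → weight x ≡ bit (head x) + weight (tail x)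
weight-∷ (true ∷ x)  = refl
weight-∷ (false ∷ x) = refl

weight-lincomb : ∀ {k n} (cf : Fin k → Bool) (g : Fin k → Word n) →
                 weight (lincomb cf g) ≡ wt (columns g) (tabulate cf)
weight-lincomb {n = zero}  cf g = weight-[] (lincomb cf g)
weight-lincomb {n = suc n} cf g = begin
  weight (lincomb cf g)
    ≡⟨ weight-∷ (lincomb cf g) ⟩
  bit (head (lincomb cf g)) + weight (tail (lincomb cf g))
    ≡⟨ cong₂ _+_ (cong bit (head-lincomb cf g)) (cong weight (tail-lincomb cf g)) ⟩
  bit (dot (tabulate cf) (tabulate (λ i → head (g i)))) + weight (lincomb cf (λ i → tail (g i)))
    ≡⟨ cong (bit (dot (tabulate cf) (tabulate (λ i → head (g i)))) +_) (weight-lincomb cf (λ i → tail (g i))) ⟩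
  wt (columns g) (tabulate cf) ∎
  where open ≡-Reasoning

all-false⇒zero : ∀ {k} (c : Word k) → (∀ i → lookup c i ≡ false) → c ≡ zeroWord
all-false⇒zero []      _        = refl
all-false⇒zero (b ∷ c) all-false = cong₂ _∷_ (all-false zero) (all-false⇒zero c (λ i → all-false (suc i)))

-- Main theorem: pass to the columns of a basis; either some coefficient
-- vector gives weight 16, or the core argument refutes the weight-15 codeword.
lemma4 : ∀ (n : ℕ) → n ≤ 33 → (C : LinearCode n 5) → HasMinDist C 15 →
         ∃ λ x → LinearCode.Code C x × weight x ≡ 16
lemma4 n n≤33 C (min15 , x , x∈C , _ , wx≡15) =
  lincomb (lookup c) basis , inCode (lookup c) , trans (weight-of c) wc≡16
  where
  open LinearCode C
  M = columns basis
  weight-of : ∀ c → weight (lincomb (lookup c) basis) ≡ wt M c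
  weight-of c = trans (weight-lincomb (lookup c) basis) (cong (wt M) (tabulate∘lookup c))
  M≤33 : length M ≤ 33
  M≤33 = subst (_≤ 33) (sym (length-columns basis)) n≤33
  min15′ : ∀ c → c ≢ zeroWord → 15 ≤ wt M c
  min15′ c c≢0 = subst (15 ≤_) (weight-of c)
    (min15 _ (inCode (lookup c)) (λ c·g≡0 → c≢0 (all-false⇒zero c (indep (lookup c) c·g≡0))))
  cx = proj₁ (spans x x∈C)
  X = tabulate cx
  wX≡15 : wt M X ≡ 15
  wX≡15 = trans (sym (weight-lincomb cx basis)) (trans (cong weight (sym (proj₂ (spans x x∈C)))) wx≡15)
  weight-16 : ∃ λ c → wt M c ≡ 16
  weight-16 = decidable-stable (exists? 5 (λ c → wt M c ≟ 16))
                (λ ∄ → no-weight-15 M M≤33 min15′ (λ c wc≡16 → ∄ (c , wc≡16)) X wX≡15)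
  c = proj₁ weight-16
  wc≡16 = proj₂ weight-16
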